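{- Let $m$ be a positive integer, and for integers $n\geq 0$ let $f_{m,n}(z)=\sum_{j=0}^{n}\binom{n}{j}z^{\binom{j}{m}}$. Then: (1) If $m$ is odd, the sequence $(f_{m,n}(-1))_{n\geq 1}$ is absolutely monotonic. (2) If $m$ is even, the sequence $(f_{m,n}(-1))_{n\geq 1}$ is not absolutely monotonic.
   Context: Here $\binom{j}{m}=0$ for $0\leq j<m$. The forward difference operator on a sequence $(a_n)$ is $\Delta a_n=a_{n+1}-a_n$, with $\Delta^0 a_n=a_n$ and $\Delta^{r+1}=\Delta\circ\Delta^r$, so that $\Delta^r a_n=\sum_{k=0}^r(-1)^k\binom{r}{k}a_{n+r-k}$. A real sequence $(a_n)_{n\geq 1}$ is called absolutely monotonic if $\Delta^r a_n\geq 0$ for all integers $r\geq 0$ and all $n\geq 1$. -}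

module Defs where

open import Data.Nat as ℕ using (ℕ; zero; suc)
open import Data.Nat.Combinatorics using (_C_)
open import Data.Integer as ℤ using (ℤ; +_; -_; _^_; _≤_)

sumTo : ℕ → (ℕ → ℤ) → ℤ
sumTo zero    g = g 0
sumTo (suc n) g = sumTo n g ℤ.+ g (suc n)

f : ℕ → ℕ → ℤ → ℤ
f m n z = sumTo n (λ j → (+ (n C j)) ℤ.* (z ^ (j C m)))

Δ : (ℕ → ℤ) → (ℕ → ℤ)
Δ a n = a (suc n) ℤ.- a n

Δ^ : ℕ → (ℕ → ℤ) → (ℕ → ℤ)
Δ^ zero    a = a
Δ^ (suc r) a = Δ (Δ^ r a)

-- a sequence (a_n)_{n ≥ 1}, represented by a function on ℕ whose values at n ≥ 1 are used,
-- is absolutely monotonic iff Δ^r a_n ≥ 0 for all r ≥ 0 and n ≥ 1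
AbsolutelyMonotonic : (ℕ → ℤ) → Set
AbsolutelyMonotonic a = ∀ (r n : ℕ) → 1 ℕ.≤ n → + 0 ≤ Δ^ r a n

{-# OPTIONS --safe #-}
-- f m n (-1) is the binomial transform  n ↦ Σ_j C(n,j) ε j  of  ε j = (-1)^C(j,m),
-- and Δ^r of a binomial transform is the transform of the r-fold shift of ε.  By
-- Pascal's rule a transform at n + 1 is Σ_j C(n,j) (ε j + ε (j + 1)), so it suffices
-- that no two consecutive ε j are both -1.  For odd m this holds because C(j,m) is
-- even for even j (absorption identity m C(j,m) = j C(j-1,m-1) and Euclid's lemma).
-- For even m, Δ^m at n = 1 equals ε m + ε (m + 1) = -1 + (-1)^(m+1) = -2.
module Submission where

open import Defs
open import Data.Nat using (ℕ; NonZero)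
open import Data.Nat.Base using (_%_)
open import Relation.Binary.PropositionalEquality using (_≡_)
open import Relation.Nullary using (¬_)
open import Data.Product using (_×_)
open import Data.Integer using (-1ℤ)

open import Data.Nat as ℕ using (zero; suc)
import Data.Nat.Properties as ℕ
open import Data.Nat.Combinatorics
  using (_C_; nCk+nC[k+1]≡[n+1]C[k+1]; nCn≡1; nC1≡n; nCk≡nC[n∸k]; k>n⇒nCk≡0)
open import Data.Nat.Divisibility using (_∣_; divides; _∣0; ∣m⇒∣m*n; m%n≡0⇒n∣m; n∣m⇒m%n≡0)
open import Data.Nat.Primality using (Prime; euclidsLemma; prime[2])
open import Data.Integer as ℤ using (ℤ; +_; -[1+_]; 0ℤ; 1ℤ; +≤+)
import Data.Integer.Properties as ℤ
import Data.Integer.Solver as ℤ-Solver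
import Data.Nat.Solver as ℕ-Solver
open import Relation.Binary.PropositionalEquality
  using (refl; sym; trans; cong; cong₂; subst; module ≡-Reasoning)
open import Data.Product using (_,_)
open import Data.Sum using (_⊎_; inj₁; inj₂)
open import Data.Empty using (⊥-elim)

sumTo-cong : ∀ n {g h : ℕ → ℤ} → (∀ j → g j ≡ h j) → sumTo n g ≡ sumTo n h
sumTo-cong zero    g≡h = g≡h 0
sumTo-cong (suc n) g≡h = cong₂ ℤ._+_ (sumTo-cong n g≡h) (g≡h (suc n))

sumTo-distrib-+ : ∀ n (g h : ℕ → ℤ) →
                  sumTo n (λ j → g j ℤ.+ h j) ≡ sumTo n g ℤ.+ sumTo n h
sumTo-distrib-+ zero    g h = refl
sumTo-distrib-+ (suc n) g h rewrite sumTo-distrib-+ n g h =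
  solve 4 (λ a b c d → (a :+ b) :+ (c :+ d) := (a :+ c) :+ (b :+ d)) refl
    (sumTo n g) (sumTo n h) (g (suc n)) (h (suc n))
  where open ℤ-Solver.+-*-Solver

sumTo-suc : ∀ n (g : ℕ → ℤ) → sumTo (suc n) g ≡ g 0 ℤ.+ sumTo n (λ j → g (suc j))
sumTo-suc zero    g = refl
sumTo-suc (suc n) g rewrite sumTo-suc n g = ℤ.+-assoc (g 0) _ _

sumTo-nonNegative : ∀ n (g : ℕ → ℤ) → (∀ j → 0ℤ ℤ.≤ g j) → 0ℤ ℤ.≤ sumTo n g
sumTo-nonNegative zero    g 0≤g = 0≤g 0
sumTo-nonNegative (suc n) g 0≤g = ℤ.+-mono-≤ (sumTo-nonNegative n g 0≤g) (0≤g (suc n))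

binomialTransform : (ℕ → ℤ) → ℕ → ℤ
binomialTransform a n = sumTo n (λ j → + (n C j) ℤ.* a j)

shift : ℕ → (ℕ → ℤ) → ℕ → ℤ
shift r a j = a (r ℕ.+ j)

binomialTransform-cong : ∀ n {a b : ℕ → ℤ} → (∀ j → a j ≡ b j) →
                         binomialTransform a n ≡ binomialTransform b n
binomialTransform-cong n a≡b = sumTo-cong n (λ j → cong (+ (n C j) ℤ.*_) (a≡b j))

binomialTransform-1 : ∀ a → binomialTransform a 1 ≡ a 0 ℤ.+ a 1
binomialTransform-1 a = cong₂ ℤ._+_ (ℤ.*-identityˡ (a 0)) (ℤ.*-identityˡ (a 1))

binomialTransform-suc : ∀ n a →
  binomialTransform a (suc n) ≡ sumTo n (λ j → + (n C j) ℤ.* (a j ℤ.+ a (suc j)))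
binomialTransform-suc n a = begin
  binomialTransform a (suc n)
    ≡⟨ sumTo-suc n _ ⟩
  aligned 0 ℤ.+ sumTo n (λ j → + (suc n C suc j) ℤ.* a (suc j))
    ≡⟨ cong (λ s → aligned 0 ℤ.+ s) (sumTo-cong n pascal) ⟩
  aligned 0 ℤ.+ sumTo n (λ j → below j ℤ.+ above j)
    ≡⟨ cong (λ s → aligned 0 ℤ.+ s) (sumTo-distrib-+ n below above) ⟩
  aligned 0 ℤ.+ (sumTo n below ℤ.+ sumTo n above)
    ≡⟨ solve 3 (λ x y z → x :+ (y :+ z) := (x :+ z) :+ y) refl (aligned 0) (sumTo n below) (sumTo n above) ⟩
  (aligned 0 ℤ.+ sumTo n above) ℤ.+ sumTo n below
    ≡⟨ cong (ℤ._+ sumTo n below) (sym (sumTo-suc n aligned)) ⟩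
  sumTo (suc n) aligned ℤ.+ sumTo n below
    ≡⟨ cong (λ x → sumTo n aligned ℤ.+ x ℤ.+ sumTo n below) aligned-beyond-n ⟩
  sumTo n aligned ℤ.+ 0ℤ ℤ.+ sumTo n below
    ≡⟨ cong (ℤ._+ sumTo n below) (ℤ.+-identityʳ (sumTo n aligned)) ⟩
  sumTo n aligned ℤ.+ sumTo n below
    ≡⟨ sym (sumTo-distrib-+ n aligned below) ⟩
  sumTo n (λ j → aligned j ℤ.+ below j)
    ≡⟨ sumTo-cong n (λ j → sym (ℤ.*-distribˡ-+ (+ (n C j)) (a j) (a (suc j)))) ⟩
  sumTo n (λ j → + (n C j) ℤ.* (a j ℤ.+ a (suc j))) ∎
  where
  open ≡-Reasoning
  open ℤ-Solver.+-*-Solver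
  aligned below above : ℕ → ℤ
  aligned j = + (n C j) ℤ.* a j
  below   j = + (n C j) ℤ.* a (suc j)
  above   j = + (n C suc j) ℤ.* a (suc j)
  aligned-beyond-n : aligned (suc n) ≡ 0ℤ
  aligned-beyond-n = trans (cong (λ c → + c ℤ.* a (suc n)) (k>n⇒nCk≡0 (ℕ.n<1+n n))) (ℤ.*-zeroˡ (a (suc n)))
  pascal : ∀ j → + (suc n C suc j) ℤ.* a (suc j) ≡ below j ℤ.+ above j
  pascal j = begin
    + (suc n C suc j) ℤ.* a (suc j)
      ≡⟨ cong (λ c → + c ℤ.* a (suc j)) (sym (nCk+nC[k+1]≡[n+1]C[k+1] n j)) ⟩
    (+ (n C j) ℤ.+ + (n C suc j)) ℤ.* a (suc j)
      ≡⟨ ℤ.*-distribʳ-+ (a (suc j)) (+ (n C j)) (+ (n C suc j)) ⟩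
    below j ℤ.+ above j ∎

binomialTransform-suc-split : ∀ n a →
  binomialTransform a (suc n) ≡ binomialTransform a n ℤ.+ binomialTransform (shift 1 a) n
binomialTransform-suc-split n a = begin
  binomialTransform a (suc n)
    ≡⟨ binomialTransform-suc n a ⟩
  sumTo n (λ j → + (n C j) ℤ.* (a j ℤ.+ a (suc j)))
    ≡⟨ sumTo-cong n (λ j → ℤ.*-distribˡ-+ (+ (n C j)) (a j) (a (suc j))) ⟩
  sumTo n (λ j → + (n C j) ℤ.* a j ℤ.+ + (n C j) ℤ.* a (suc j))
    ≡⟨ sumTo-distrib-+ n _ _ ⟩
  binomialTransform a n ℤ.+ binomialTransform (shift 1 a) n ∎
  where open ≡-Reasoning

Δ-binomialTransform : ∀ a n → Δ (binomialTransform a) n ≡ binomialTransform (shift 1 a) n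
Δ-binomialTransform a n rewrite binomialTransform-suc-split n a =
  solve 2 (λ x y → (x :+ y) :- x := y) refl (binomialTransform a n) (binomialTransform (shift 1 a) n)
  where open ℤ-Solver.+-*-Solver

Δ^-binomialTransform : ∀ r a n → Δ^ r (binomialTransform a) n ≡ binomialTransform (shift r a) n
Δ^-binomialTransform zero    a n = refl
Δ^-binomialTransform (suc r) a n
  rewrite Δ^-binomialTransform r a (suc n) | Δ^-binomialTransform r a n =
  trans (Δ-binomialTransform (shift r a) n)
        (binomialTransform-cong n (λ j → cong a (ℕ.+-suc r j)))

binomialTransform-suc-nonNegative : ∀ a → (∀ j → 0ℤ ℤ.≤ a j ℤ.+ a (suc j)) →
                                    ∀ n → 0ℤ ℤ.≤ binomialTransform a (suc n)
binomialTransform-suc-nonNegative a 0≤a+a n rewrite binomialTransform-suc n a =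
  sumTo-nonNegative n _ (λ j → 0≤+k*i (n C j) (0≤a+a j))
  where
  0≤+k*i : ∀ k {i} → 0ℤ ℤ.≤ i → 0ℤ ℤ.≤ + k ℤ.* i
  0≤+k*i k {i} 0≤i = subst (ℤ._≤ + k ℤ.* i) (ℤ.*-zeroʳ (+ k)) (ℤ.*-monoˡ-≤-nonNeg (+ k) 0≤i)

binomialTransform-absolutelyMonotonic : ∀ a → (∀ j → 0ℤ ℤ.≤ a j ℤ.+ a (suc j)) →
                                        AbsolutelyMonotonic (binomialTransform a)
binomialTransform-absolutelyMonotonic a 0≤a+a r (suc n) _
  rewrite Δ^-binomialTransform r a (suc n) =
  binomialTransform-suc-nonNegative (shift r a) 0≤shift+shift n
  where
  0≤shift+shift : ∀ j → 0ℤ ℤ.≤ shift r a j ℤ.+ shift r a (suc j)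
  0≤shift+shift j rewrite ℕ.+-suc r j = 0≤a+a (r ℕ.+ j)

[1+k]*[1+n]C[1+k]≡[1+n]*nCk : ∀ n k → suc k ℕ.* (suc n C suc k) ≡ suc n ℕ.* (n C k)
[1+k]*[1+n]C[1+k]≡[1+n]*nCk zero    zero    = refl
[1+k]*[1+n]C[1+k]≡[1+n]*nCk zero    (suc k) = ℕ.*-zeroʳ (suc (suc k))
[1+k]*[1+n]C[1+k]≡[1+n]*nCk (suc n) zero    =
  trans (ℕ.*-identityˡ _) (trans (nC1≡n (suc (suc n))) (sym (ℕ.*-identityʳ _)))
[1+k]*[1+n]C[1+k]≡[1+n]*nCk (suc n) (suc k) = begin
  suc (suc k) ℕ.* (suc (suc n) C suc (suc k))
    ≡⟨ cong (suc (suc k) ℕ.*_) (sym (nCk+nC[k+1]≡[n+1]C[k+1] (suc n) (suc k))) ⟩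
  suc (suc k) ℕ.* (A ℕ.+ B)
    ≡⟨ solve 3 (λ k A B → (con 2 :+ k) :* (A :+ B) := ((con 1 :+ k) :* A :+ A) :+ (con 2 :+ k) :* B) refl k A B ⟩
  (suc k ℕ.* A ℕ.+ A) ℕ.+ suc (suc k) ℕ.* B
    ≡⟨ cong₂ (λ x y → (x ℕ.+ A) ℕ.+ y) ([1+k]*[1+n]C[1+k]≡[1+n]*nCk n k) ([1+k]*[1+n]C[1+k]≡[1+n]*nCk n (suc k)) ⟩
  (suc n ℕ.* (n C k) ℕ.+ A) ℕ.+ suc n ℕ.* (n C suc k)
    ≡⟨ solve 4 (λ n x A y → ((con 1 :+ n) :* x :+ A) :+ (con 1 :+ n) :* y := (con 1 :+ n) :* (x :+ y) :+ A) refl n (n C k) A (n C suc k) ⟩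
  suc n ℕ.* (n C k ℕ.+ n C suc k) ℕ.+ A
    ≡⟨ cong (λ x → suc n ℕ.* x ℕ.+ A) (nCk+nC[k+1]≡[n+1]C[k+1] n k) ⟩
  suc n ℕ.* A ℕ.+ A
    ≡⟨ solve 2 (λ n A → (con 1 :+ n) :* A :+ A := (con 2 :+ n) :* A) refl n A ⟩
  suc (suc n) ℕ.* A ∎
  where
  open ≡-Reasoning
  open ℕ-Solver.+-*-Solver
  A B : ℕ
  A = suc n C suc k
  B = suc n C suc (suc k)

p∣n⇒p∣nCk : ∀ {p} n k → Prime p → ¬ p ∣ k → p ∣ n → p ∣ n C k
p∣n⇒p∣nCk {p} n       zero    _     p∤k _   = ⊥-elim (p∤k (p ∣0))
p∣n⇒p∣nCk {p} zero    (suc k) _     _   _   = p ∣0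
p∣n⇒p∣nCk {p} (suc n) (suc k) p-prime p∤k p∣n
  with euclidsLemma (suc k) (suc n C suc k) p-prime
         (subst (p ∣_) (sym ([1+k]*[1+n]C[1+k]≡[1+n]*nCk n k)) (∣m⇒∣m*n (n C k) p∣n))
... | inj₁ p∣k    = ⊥-elim (p∤k p∣k)
... | inj₂ p∣nCk  = p∣nCk

2∣n⊎2∣1+n : ∀ n → 2 ∣ n ⊎ 2 ∣ suc n
2∣n⊎2∣1+n zero    = inj₁ (2 ∣0)
2∣n⊎2∣1+n (suc n) with 2∣n⊎2∣1+n n
... | inj₁ (divides q n≡q*2) = inj₂ (divides (suc q) (cong (λ x → suc (suc x)) n≡q*2))
... | inj₂ 2∣1+n             = inj₁ 2∣1+n

-1^even≡1 : ∀ {k} → 2 ∣ k → -1ℤ ℤ.^ k ≡ 1ℤ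
-1^even≡1 (divides q refl) rewrite ℕ.*-comm q 2 = trans (sym (ℤ.^-*-assoc -1ℤ 2 q)) (ℤ.^-zeroˡ q)

-1^k≡1⊎-1^k≡-1 : ∀ k → -1ℤ ℤ.^ k ≡ 1ℤ ⊎ -1ℤ ℤ.^ k ≡ -1ℤ
-1^k≡1⊎-1^k≡-1 zero = inj₁ refl
-1^k≡1⊎-1^k≡-1 (suc k) with -1^k≡1⊎-1^k≡-1 k
... | inj₁ eq rewrite eq = inj₂ refl
... | inj₂ eq rewrite eq = inj₁ refl

0≤1+-1^k : ∀ k → 0ℤ ℤ.≤ 1ℤ ℤ.+ -1ℤ ℤ.^ k
0≤1+-1^k k with -1^k≡1⊎-1^k≡-1 k
... | inj₁ eq rewrite eq = +≤+ ℕ.z≤n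
... | inj₂ eq rewrite eq = +≤+ ℕ.z≤n

0≤-1^[nCm]+-1^[[1+n]Cm] : ∀ {m} → ¬ 2 ∣ m → ∀ n → 0ℤ ℤ.≤ -1ℤ ℤ.^ (n C m) ℤ.+ -1ℤ ℤ.^ (suc n C m)
0≤-1^[nCm]+-1^[[1+n]Cm] {m} 2∤m n with 2∣n⊎2∣1+n n
... | inj₁ 2∣n   rewrite -1^even≡1 (p∣n⇒p∣nCk n m prime[2] 2∤m 2∣n) = 0≤1+-1^k (suc n C m)
... | inj₂ 2∣1+n rewrite -1^even≡1 (p∣n⇒p∣nCk (suc n) m prime[2] 2∤m 2∣1+n) =
  subst (0ℤ ℤ.≤_) (ℤ.+-comm 1ℤ (-1ℤ ℤ.^ (n C m))) (0≤1+-1^k (n C m))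

Δ^m-at-1≡-2 : ∀ {m} → 2 ∣ m → Δ^ m (binomialTransform (λ j → -1ℤ ℤ.^ (j C m))) 1 ≡ -[1+ 1 ]
Δ^m-at-1≡-2 {m} 2∣m = begin
  Δ^ m (binomialTransform ε) 1             ≡⟨ Δ^-binomialTransform m ε 1 ⟩
  binomialTransform (shift m ε) 1          ≡⟨ binomialTransform-1 (shift m ε) ⟩
  ε (m ℕ.+ 0) ℤ.+ ε (m ℕ.+ 1)              ≡⟨ cong₂ ℤ._+_ ε[m]≡-1 ε[m+1]≡-1 ⟩
  -[1+ 1 ]                                 ∎
  where
  open ≡-Reasoning
  ε : ℕ → ℤ
  ε j = -1ℤ ℤ.^ (j C m)
  ε[m]≡-1 : ε (m ℕ.+ 0) ≡ -1ℤ
  ε[m]≡-1 rewrite ℕ.+-identityʳ m | nCn≡1 m = refl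
  [1+m]Cm≡1+m : suc m C m ≡ suc m
  [1+m]Cm≡1+m = trans (nCk≡nC[n∸k] (ℕ.n≤1+n m)) (trans (cong (suc m C_) (ℕ.m+n∸n≡m 1 m)) (nC1≡n (suc m)))
  ε[m+1]≡-1 : ε (m ℕ.+ 1) ≡ -1ℤ
  ε[m+1]≡-1 rewrite ℕ.+-comm m 1 | [1+m]Cm≡1+m | -1^even≡1 2∣m = refl

proposition2p2 : (m : ℕ) → NonZero m →
    ((m % 2 ≡ 1 → AbsolutelyMonotonic (λ n → f m n -1ℤ))
    × (m % 2 ≡ 0 → ¬ AbsolutelyMonotonic (λ n → f m n -1ℤ)))
proposition2p2 m _ = odd , even
  where
  odd : m % 2 ≡ 1 → AbsolutelyMonotonic (λ n → f m n -1ℤ)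
  odd m%2≡1 = binomialTransform-absolutelyMonotonic _ (0≤-1^[nCm]+-1^[[1+n]Cm] 2∤m)
    where
    2∤m : ¬ 2 ∣ m
    2∤m 2∣m with trans (sym m%2≡1) (n∣m⇒m%n≡0 m 2 2∣m)
    ... | ()
  even : m % 2 ≡ 0 → ¬ AbsolutelyMonotonic (λ n → f m n -1ℤ)
  even m%2≡0 monotonic with subst (0ℤ ℤ.≤_) (Δ^m-at-1≡-2 (m%n≡0⇒n∣m m 2 m%2≡0)) (monotonic m 1 (ℕ.s≤s ℕ.z≤n))
  ... | ()
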